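{- In the logic DmBL, for every integer $t\ge2$ and all $\phi_1,\dots,\phi_t\in\mathcal{L}$: $$\vdash\left(\left(\bigwedge_{\tau=1}^{t-2}\bigl((\phi_t|\phi_{t-1})\times\phi_{\tau}\bigr)\right)\wedge\Diamond\left(\bigwedge_{\tau=1}^{t-1}\phi_{\tau}\right)\right)\longrightarrow\Box\left((\phi_t|\phi_{t-1})\leftrightarrow\left(\phi_t\left|\bigwedge_{\tau=1}^{t-1}\phi_{\tau}\right.\right)\right).$$
   Context: Fix a set $\Theta$ of atomic propositions. The language $\mathcal{L}$ is the smallest set containing $\Theta$ and closed under the formation of $\neg\phi$, $\Box\phi$, $\phi\rightarrow\psi$ and the conditional $(\psi|\phi)$. Abbreviations: $\phi\vee\psi=\neg\phi\rightarrow\psi$, $\phi\wedge\psi=\neg(\neg\phi\vee\neg\psi)$, $\phi\leftrightarrow\psi=(\phi\rightarrow\psi)\wedge(\psi\rightarrow\phi)$, $\top=\theta_0\rightarrow\theta_0$ for a fixed $\theta_0\in\Theta$, $\bot=\neg\top$, $\Diamond\phi=\neg\Box\neg\phi$, and (logical independence) $\psi\times\phi=\Box\bigl((\psi|\phi)\leftrightarrow\psi\bigr)$. An empty conjunction is $\top$. The theorems ($\vdash$) of DmBL are the smallest set containing all instances of the axiom schemes below and closed under modus ponens (from $\vdash\phi$ and $\vdash\phi\rightarrow\psi$ infer $\vdash\psi$) and necessitation m1 (from $\vdash\phi$ infer $\vdash\Box\phi$): c1 $\phi\rightarrow(\psi\rightarrow\phi)$; c2 $(\eta\rightarrow(\phi\rightarrow\psi))\rightarrow((\eta\rightarrow\phi)\rightarrow(\eta\rightarrow\psi))$;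 c3 $(\neg\phi\rightarrow\neg\psi)\rightarrow((\neg\phi\rightarrow\psi)\rightarrow\phi)$; m2 $\Box(\phi\rightarrow\psi)\rightarrow(\Box\phi\rightarrow\Box\psi)$; m3 $\Box\phi\rightarrow\phi$; b1 $\Box(\phi\rightarrow\psi)\rightarrow(\Box\neg\phi\vee\Box(\psi|\phi))$; b2 $((\psi\rightarrow\eta)|\phi)\rightarrow((\psi|\phi)\rightarrow(\eta|\phi))$; b3 $(\psi|\phi)\rightarrow(\phi\rightarrow\psi)$; b4 $\neg(\neg\psi|\phi)\leftrightarrow(\psi|\phi)$; b5 $(\psi\times\phi)\leftrightarrow(\phi\times\psi)$. -}

module Defs where

open import Data.Nat using (ℕ; zero; suc)
open import Data.Fin using (Fin; zero; suc; fromℕ; inject₁)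
open import Data.List using (List; []; _∷_)

data Form (Θ : Set) : Set where
  atom : Θ → Form Θ
  ¬'_  : Form Θ → Form Θ
  □_   : Form Θ → Form Θ
  _⇒_  : Form Θ → Form Θ → Form Θ
  _∣_  : Form Θ → Form Θ → Form Θ

infixr 6 _⇒_
infix 9 ¬'_ □_

module Abbrev {Θ : Set} (θ₀ : Θ) where
  _∨'_ : Form Θ → Form Θ → Form Θ
  φ ∨' ψ = (¬' φ) ⇒ ψ

  _∧'_ : Form Θ → Form Θ → Form Θ
  φ ∧' ψ = ¬' ((¬' φ) ∨' (¬' ψ))

  _⇔_ : Form Θ → Form Θ → Form Θ
  φ ⇔ ψ = (φ ⇒ ψ) ∧' (ψ ⇒ φ)

  ⊤' : Form Θ
  ⊤' = atom θ₀ ⇒ atom θ₀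

  ⊥' : Form Θ
  ⊥' = ¬' ⊤'

  ◇_ : Form Θ → Form Θ
  ◇ φ = ¬' (□ (¬' φ))

  _⨯_ : Form Θ → Form Θ → Form Θ
  ψ ⨯ φ = □ ((ψ ∣ φ) ⇔ ψ)

  ⋀ : List (Form Θ) → Form Θ
  ⋀ []           = ⊤'
  ⋀ (φ ∷ [])     = φ
  ⋀ (φ ∷ ψ ∷ φs) = φ ∧' ⋀ (ψ ∷ φs)

  data ⊢_ : Form Θ → Set where
    c1 : ∀ φ ψ → ⊢ (φ ⇒ (ψ ⇒ φ))
    c2 : ∀ η φ ψ → ⊢ ((η ⇒ (φ ⇒ ψ)) ⇒ ((η ⇒ φ) ⇒ (η ⇒ ψ)))
    c3 : ∀ φ ψ → ⊢ (((¬' φ) ⇒ (¬' ψ)) ⇒ (((¬' φ) ⇒ ψ) ⇒ φ))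
    m2 : ∀ φ ψ → ⊢ ((□ (φ ⇒ ψ)) ⇒ ((□ φ) ⇒ (□ ψ)))
    m3 : ∀ φ → ⊢ ((□ φ) ⇒ φ)
    b1 : ∀ φ ψ → ⊢ ((□ (φ ⇒ ψ)) ⇒ ((□ (¬' φ)) ∨' (□ (ψ ∣ φ))))
    b2 : ∀ φ ψ η → ⊢ (((ψ ⇒ η) ∣ φ) ⇒ ((ψ ∣ φ) ⇒ (η ∣ φ)))
    b3 : ∀ φ ψ → ⊢ ((ψ ∣ φ) ⇒ (φ ⇒ ψ))
    b4 : ∀ φ ψ → ⊢ ((¬' ((¬' ψ) ∣ φ)) ⇔ (ψ ∣ φ))
    b5 : ∀ φ ψ → ⊢ ((ψ ⨯ φ) ⇔ (φ ⨯ ψ))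
    mp : ∀ {φ ψ} → ⊢ φ → ⊢ (φ ⇒ ψ) → ⊢ ψ
    nec : ∀ {φ} → ⊢ φ → ⊢ (□ φ)

prefix : ∀ {A : Set} {m : ℕ} → (k : ℕ) → (Fin m → A) → List A
prefix zero    f = []
prefix {m = zero}  (suc k) f = []
prefix {m = suc m} (suc k) f = f zero ∷ prefix k (λ i → f (suc i))

{-# OPTIONS --safe #-}
module Submission where

-- Write C = (φₜ|φₜ₋₁) and Φ = φ₁ ∧ … ∧ φₜ₋₁. Under the antecedent φₜ₋₁ the
-- conditional C is equivalent to φₜ, so by b1 (with ◇φₜ₋₁, which follows from
-- ◇Φ) C is independent of φₜ₋₁, and by b5 each φ_τ is independent of C. Now
-- split on whether C is possible. If □¬C, then □(Φ → ¬φₜ), hence □(¬φₜ|Φ) and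
-- both sides of the goal are necessarily false. If ◇C, b1 applies to
-- conditionals on C, so independence from C passes from the φ_τ to their
-- conjunction Φ, and by b5 (C|Φ) ↔ C; since Φ entails φₜ₋₁, b1 also turns
-- C ↔ φₜ under Φ into (C|Φ) ↔ (φₜ|Φ).

open import Defs
open import Data.Nat using (ℕ; zero; suc)
open import Data.Fin using (Fin; fromℕ; inject₁; zero; suc)
open import Data.List using (List; []; _∷_; map; _++_)
open import Data.List.Relation.Unary.All as All using (All; []; _∷_)
open import Data.List.Relation.Unary.All.Properties using (map⁻; ++⁺; ++⁻ʳ)
open import Data.List.Relation.Unary.Any using (here; there)
open import Data.List.Membership.Propositional using (_∈_)
open import Relation.Binary.PropositionalEquality using (_≡_; refl; sym; cong; subst)

module Derivations {Θ : Set} (θ₀ : Θ) where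
  open Abbrev θ₀

  private variable
    Γ : List (Form Θ)
    A B C P Q X Y Φ : Form Θ

  -- There is no necessitation of hypotheses, only closed theorems via thm;
  -- this is what keeps the deduction theorem ⇒-intro valid.
  infix 2 _⊩_
  data _⊩_ (Γ : List (Form Θ)) : Form Θ → Set where
    hyp    : A ∈ Γ → Γ ⊩ A
    thm    : ⊢ A → Γ ⊩ A
    ⇒-elim : Γ ⊩ (A ⇒ B) → Γ ⊩ A → Γ ⊩ B

  ⇒-refl : ∀ A → ⊢ (A ⇒ A)
  ⇒-refl A = mp (c1 A A) (mp (c1 A (A ⇒ A)) (c2 A (A ⇒ A) A))

  ⇒-intro : (A ∷ Γ) ⊩ B → Γ ⊩ (A ⇒ B)
  ⇒-intro {A = A} (hyp (here refl)) = thm (⇒-refl A)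
  ⇒-intro {A = A} (hyp (there p))   = ⇒-elim (thm (c1 _ A)) (hyp p)
  ⇒-intro {A = A} (thm t)           = ⇒-elim (thm (c1 _ A)) (thm t)
  ⇒-intro (⇒-elim d e)              = ⇒-elim (⇒-elim (thm (c2 _ _ _)) (⇒-intro d)) (⇒-intro e)

  closed : [] ⊩ A → ⊢ A
  closed (thm t)      = t
  closed (⇒-elim d e) = mp (closed e) (closed d)

  weaken : Γ ⊩ A → (B ∷ Γ) ⊩ A
  weaken (hyp p)      = hyp (there p)
  weaken (thm t)      = thm t
  weaken (⇒-elim d e) = ⇒-elim (weaken d) (weaken e)

  #0 : (A ∷ Γ) ⊩ A
  #0 = hyp (here refl)

  #1 : (B ∷ A ∷ Γ) ⊩ A
  #1 = weaken #0

  #2 : (C ∷ B ∷ A ∷ Γ) ⊩ A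
  #2 = weaken #1

  #3 : (X ∷ C ∷ B ∷ A ∷ Γ) ⊩ A
  #3 = weaken #2

  #4 : (Y ∷ X ∷ C ∷ B ∷ A ∷ Γ) ⊩ A
  #4 = weaken #3

  ⇒-trans : ⊢ (A ⇒ B) → ⊢ (B ⇒ C) → ⊢ (A ⇒ C)
  ⇒-trans f g = closed (⇒-intro (⇒-elim (thm g) (⇒-elim (thm f) #0)))

  ⇒-const : Γ ⊩ A → Γ ⊩ (B ⇒ A)
  ⇒-const {A = A} {B = B} a = ⇒-elim (thm (c1 A B)) a

  by-contradiction : ((¬' A) ∷ Γ) ⊩ B → ((¬' A) ∷ Γ) ⊩ (¬' B) → Γ ⊩ A
  by-contradiction {A = A} {B = B} b nb =
    ⇒-elim (⇒-elim (thm (c3 A B)) (⇒-intro nb)) (⇒-intro b)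

  ¬¬-elim : Γ ⊩ (¬' (¬' A)) → Γ ⊩ A
  ¬¬-elim nna = by-contradiction #0 (weaken nna)

  ¬¬-intro : Γ ⊩ A → Γ ⊩ (¬' (¬' A))
  ¬¬-intro a = by-contradiction (weaken a) (¬¬-elim #0)

  contradiction : Γ ⊩ A → Γ ⊩ (¬' A) → Γ ⊩ B
  contradiction a na = by-contradiction (weaken a) (weaken na)

  ¬-intro : (A ∷ Γ) ⊩ B → (A ∷ Γ) ⊩ (¬' B) → Γ ⊩ (¬' A)
  ¬-intro b nb = by-contradiction (⇒-elim (weaken (⇒-intro b)) (¬¬-elim #0))
                                  (⇒-elim (weaken (⇒-intro nb)) (¬¬-elim #0))

  by-cases : (X ∷ Γ) ⊩ B → ((¬' X) ∷ Γ) ⊩ B → Γ ⊩ B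
  by-cases x⇒b ¬x⇒b =
    by-contradiction (⇒-elim (weaken (⇒-intro ¬x⇒b))
                             (¬-intro (⇒-elim (weaken (weaken (⇒-intro x⇒b))) #0) #1))
                     #0

  ∧-intro : Γ ⊩ A → Γ ⊩ B → Γ ⊩ (A ∧' B)
  ∧-intro a b = ¬-intro (weaken b) (⇒-elim #0 (¬¬-intro (weaken a)))

  ∧-elimˡ : Γ ⊩ (A ∧' B) → Γ ⊩ A
  ∧-elimˡ ab = by-contradiction (⇒-intro (contradiction #1 #0)) (weaken ab)

  ∧-elimʳ : Γ ⊩ (A ∧' B) → Γ ⊩ B
  ∧-elimʳ ab = by-contradiction (⇒-const #0) (weaken ab)

  ⇔-intro : (A ∷ Γ) ⊩ B → (B ∷ Γ) ⊩ A → Γ ⊩ (A ⇔ B)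
  ⇔-intro a⇒b b⇒a = ∧-intro (⇒-intro a⇒b) (⇒-intro b⇒a)

  ⇔-to : Γ ⊩ (A ⇔ B) → Γ ⊩ A → Γ ⊩ B
  ⇔-to a⇔b = ⇒-elim (∧-elimˡ a⇔b)

  ⇔-from : Γ ⊩ (A ⇔ B) → Γ ⊩ B → Γ ⊩ A
  ⇔-from a⇔b = ⇒-elim (∧-elimʳ a⇔b)

  ⇔-trans : Γ ⊩ (A ⇔ B) → Γ ⊩ (B ⇔ C) → Γ ⊩ (A ⇔ C)
  ⇔-trans a⇔b b⇔c = ⇔-intro (⇔-to (weaken b⇔c) (⇔-to (weaken a⇔b) #0))
                            (⇔-from (weaken a⇔b) (⇔-from (weaken b⇔c) #0))

  ⇔-sym : Γ ⊩ (A ⇔ B) → Γ ⊩ (B ⇔ A)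
  ⇔-sym a⇔b = ⇔-intro (⇔-from (weaken a⇔b) #0) (⇔-to (weaken a⇔b) #0)

  ⋀-elim : ∀ L → Γ ⊩ ⋀ L → All (Γ ⊩_) L
  ⋀-elim []           _  = []
  ⋀-elim (A ∷ [])     a  = a ∷ []
  ⋀-elim (A ∷ B ∷ L) ab = ∧-elimˡ ab ∷ ⋀-elim (B ∷ L) (∧-elimʳ ab)

  □-thm : ⊢ A → Γ ⊩ □ A
  □-thm a = thm (nec a)

  □-lift : ∀ Δ → Δ ⊩ B → All (λ A → Γ ⊩ □ A) Δ → Γ ⊩ □ B
  □-lift []      b []         = □-thm (closed b)
  □-lift (A ∷ Δ) b (□a ∷ □Δ) = ⇒-elim (⇒-elim (thm (m2 A _)) (□-lift Δ (⇒-intro b) □Δ)) □a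

  ◇-mono : ⊢ (A ⇒ B) → Γ ⊩ ◇ A → Γ ⊩ ◇ B
  ◇-mono {B = B} a⇒b ◇a =
    ¬-intro (□-lift (¬' B ∷ []) (¬-intro (⇒-elim (thm a⇒b) #0) #1) (#0 ∷ [])) (weaken ◇a)

  □-cond-intro : Γ ⊩ □ (A ⇒ X) → Γ ⊩ ◇ A → Γ ⊩ □ (X ∣ A)
  □-cond-intro {A = A} {X = X} □a⇒x ◇a = ⇒-elim (⇒-elim (thm (b1 A X)) □a⇒x) ◇a

  □-cond-theorem : ⊢ X → Γ ⊩ ◇ A → Γ ⊩ □ (X ∣ A)
  □-cond-theorem {X = X} {A = A} x = □-cond-intro (□-thm (mp x (c1 X A)))

  cond-mp : Γ ⊩ ((X ⇒ Y) ∣ A) → Γ ⊩ (X ∣ A) → Γ ⊩ (Y ∣ A)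
  cond-mp {X = X} {Y = Y} {A = A} x⇒y x = ⇒-elim (⇒-elim (thm (b2 A X Y)) x⇒y) x

  cond-¬⇒¬-cond : Γ ⊩ ((¬' X) ∣ A) → Γ ⊩ (¬' (X ∣ A))
  cond-¬⇒¬-cond {X = X} {A = A} ¬x = ¬-intro (⇔-from (thm (b4 A X)) #0) (¬¬-intro (weaken ¬x))

  ¬-cond⇒cond-¬ : Γ ⊩ (¬' (X ∣ A)) → Γ ⊩ ((¬' X) ∣ A)
  ¬-cond⇒cond-¬ {X = X} {A = A} ¬x = by-contradiction (⇔-to (thm (b4 A X)) #0) (weaken ¬x)

  cond-¬¬-intro : Γ ⊩ (X ∣ A) → Γ ⊩ ((¬' (¬' X)) ∣ A)
  cond-¬¬-intro x = ¬-cond⇒cond-¬ (¬-intro (weaken x) (cond-¬⇒¬-cond #0))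

  cond-∧-intro : Γ ⊩ (X ∣ A) → Γ ⊩ (Y ∣ A) → Γ ⊩ ((X ∧' Y) ∣ A)
  cond-∧-intro x y =
    ¬-cond⇒cond-¬ (¬-intro (weaken y) (cond-¬⇒¬-cond (cond-mp #0 (cond-¬¬-intro (weaken x)))))

  □-cond-cong : Γ ⊩ □ (A ⇒ (X ⇔ Y)) → Γ ⊩ ◇ A → Γ ⊩ □ ((X ∣ A) ⇔ (Y ∣ A))
  □-cond-cong {A = A} {X = X} {Y = Y} □a⇒x⇔y ◇a =
    □-lift (((X ⇒ Y) ∣ A) ∷ ((Y ⇒ X) ∣ A) ∷ [])
           (⇔-intro (cond-mp #1 #0) (cond-mp #2 #0))
           (□-cond-intro (□-lift (_ ∷ []) (⇒-intro (⇒-intro (⇔-to (⇒-elim #2 #1) #0)))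
                                 (□a⇒x⇔y ∷ [])) ◇a
           ∷ □-cond-intro (□-lift (_ ∷ []) (⇒-intro (⇒-intro (⇔-from (⇒-elim #2 #1) #0)))
                                 (□a⇒x⇔y ∷ [])) ◇a
           ∷ [])

  ⨯-sym : Γ ⊩ (X ⨯ Y) → Γ ⊩ (Y ⨯ X)
  ⨯-sym {X = X} {Y = Y} = ⇔-to (thm (b5 Y X))

  ⊤-⨯ : Γ ⊩ ◇ C → Γ ⊩ (⊤' ⨯ C)
  ⊤-⨯ {C = C} ◇c =
    □-lift ((⊤' ∣ C) ∷ []) (⇔-intro (thm (⇒-refl (atom θ₀))) #1)
           (□-cond-theorem (⇒-refl (atom θ₀)) ◇c ∷ [])

  ∧-⨯ : Γ ⊩ ◇ C → Γ ⊩ (A ⨯ C) → Γ ⊩ (B ⨯ C) → Γ ⊩ ((A ∧' B) ⨯ C)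
  ∧-⨯ {C = C} {A = A} {B = B} ◇c a⨯c b⨯c =
    □-lift ((((A ∧' B) ⇒ A) ∣ C) ∷ (((A ∧' B) ⇒ B) ∣ C) ∷ ((A ∣ C) ⇔ A) ∷ ((B ∣ C) ⇔ B) ∷ [])
           (⇔-intro (∧-intro (⇔-to #3 (cond-mp #1 #0)) (⇔-to #4 (cond-mp #2 #0)))
                    (cond-∧-intro (⇔-from #3 (∧-elimˡ #0)) (⇔-from #4 (∧-elimʳ #0))))
           (□-cond-theorem (closed (⇒-intro (∧-elimˡ #0))) ◇c
           ∷ □-cond-theorem (closed (⇒-intro (∧-elimʳ #0))) ◇c
           ∷ a⨯c ∷ b⨯c ∷ [])

  ⋀-⨯ : ∀ L → Γ ⊩ ◇ C → All (λ A → Γ ⊩ (A ⨯ C)) L → Γ ⊩ (⋀ L ⨯ C)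
  ⋀-⨯ []          ◇c []             = ⊤-⨯ ◇c
  ⋀-⨯ (A ∷ [])    ◇c (a⨯c ∷ [])     = a⨯c
  ⋀-⨯ (A ∷ B ∷ L) ◇c (a⨯c ∷ b∷L⨯c) = ∧-⨯ ◇c a⨯c (⋀-⨯ (B ∷ L) ◇c b∷L⨯c)

  cond-⇔-under-antecedent : ⊢ (P ⇒ ((Q ∣ P) ⇔ Q))
  cond-⇔-under-antecedent {P = P} {Q = Q} =
    closed (⇒-intro (⇔-intro
      (⇒-elim (⇒-elim (thm (b3 P Q)) #0) #1)
      (by-contradiction #1 (⇒-elim (⇒-elim (thm (b3 P (¬' Q))) (¬-cond⇒cond-¬ #0)) #2))))

  cond-⨯-antecedent : Γ ⊩ ◇ P → Γ ⊩ ((Q ∣ P) ⨯ P)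
  cond-⨯-antecedent ◇p = □-cond-cong (□-thm cond-⇔-under-antecedent) ◇p

  strengthen-antecedent-⨯ : ⊢ (Φ ⇒ P) → Γ ⊩ ◇ Φ → Γ ⊩ ((Q ∣ P) ⨯ Φ) →
                            Γ ⊩ □ ((Q ∣ P) ⇔ (Q ∣ Φ))
  strengthen-antecedent-⨯ φ⇒p ◇φ c⨯φ =
    □-lift (_ ∷ _ ∷ []) (⇔-trans (⇔-sym #0) #1)
           (c⨯φ ∷ □-cond-cong (□-thm (⇒-trans φ⇒p cond-⇔-under-antecedent)) ◇φ ∷ [])

  strengthen-antecedent-□¬ : ⊢ (Φ ⇒ P) → Γ ⊩ ◇ Φ → Γ ⊩ □ (¬' (Q ∣ P)) →
                             Γ ⊩ □ ((Q ∣ P) ⇔ (Q ∣ Φ))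
  strengthen-antecedent-□¬ {Φ = Φ} {P = P} {Γ = Γ} {Q = Q} φ⇒p ◇φ □¬c =
    □-lift (_ ∷ ((¬' Q) ∣ Φ) ∷ [])
           (⇔-intro (contradiction #0 #1) (contradiction #0 (cond-¬⇒¬-cond #2)))
           (□¬c ∷ □-cond-intro □φ⇒¬q ◇φ ∷ [])
    where
    □φ⇒¬q : Γ ⊩ □ (Φ ⇒ (¬' Q))
    □φ⇒¬q = □-lift (_ ∷ []) (⇒-intro (¬-intro (⇔-from (⇒-elim (thm φ⇒c⇔q) #1) #0) #2)) (□¬c ∷ [])
      where
      φ⇒c⇔q : ⊢ (Φ ⇒ ((Q ∣ P) ⇔ Q))
      φ⇒c⇔q = ⇒-trans φ⇒p cond-⇔-under-antecedent

  strengthen-antecedent-⋀ : ∀ L P Q →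
    ⊢ ((⋀ (map ((Q ∣ P) ⨯_) L) ∧' (◇ (⋀ (L ++ P ∷ [])))) ⇒ (□ ((Q ∣ P) ⇔ (Q ∣ ⋀ (L ++ P ∷ [])))))
  strengthen-antecedent-⋀ L P Q = closed (⇒-intro (by-cases
    (strengthen-antecedent-□¬ ⋀⇒p (weaken ◇⋀) #0)
    (strengthen-antecedent-⨯ ⋀⇒p (weaken ◇⋀)
      (⨯-sym (⋀-⨯ (L ++ P ∷ []) #0 (All.map weaken conjuncts⨯c))))))
    where
    hypothesis : List (Form Θ)
    hypothesis = (⋀ (map ((Q ∣ P) ⨯_) L) ∧' (◇ (⋀ (L ++ P ∷ [])))) ∷ []

    ⋀⇒p : ⊢ (⋀ (L ++ P ∷ []) ⇒ P)
    ⋀⇒p = closed (⇒-intro (All.head (++⁻ʳ L (⋀-elim (L ++ P ∷ []) #0))))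

    ◇⋀ : hypothesis ⊩ ◇ (⋀ (L ++ P ∷ []))
    ◇⋀ = ∧-elimʳ #0

    conjuncts⨯c : All (λ A → hypothesis ⊩ (A ⨯ (Q ∣ P))) (L ++ P ∷ [])
    conjuncts⨯c = ++⁺ (All.map ⨯-sym (map⁻ (⋀-elim (map ((Q ∣ P) ⨯_) L) (∧-elimˡ #0))))
                      (⨯-sym (cond-⨯-antecedent (◇-mono ⋀⇒p ◇⋀)) ∷ [])

prefix-suc : ∀ {A : Set} n (φ : Fin (suc (suc n)) → A) →
             prefix (suc n) φ ≡ prefix n φ ++ φ (inject₁ (fromℕ n)) ∷ []
prefix-suc zero    φ = refl
prefix-suc (suc n) φ = cong (φ zero ∷_) (prefix-suc n (λ i → φ (suc i)))

mainTheorem12 : {Θ : Set} (θ₀ : Θ) (n : ℕ) (φ : Fin (suc (suc n)) → Form Θ) →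
    let open Abbrev θ₀
        φt  = φ (fromℕ (suc n))
        φt1 = φ (inject₁ (fromℕ n))
    in ⊢ ((⋀ (map (λ ψ → (φt ∣ φt1) ⨯ ψ) (prefix n φ)) ∧' (◇ (⋀ (prefix (suc n) φ))))
          ⇒ (□ ((φt ∣ φt1) ⇔ (φt ∣ ⋀ (prefix (suc n) φ)))))
mainTheorem12 θ₀ n φ =
  subst (λ Φs → ⊢ ((⋀ (map ((φt ∣ φt1) ⨯_) (prefix n φ)) ∧' (◇ (⋀ Φs))) ⇒ (□ ((φt ∣ φt1) ⇔ (φt ∣ ⋀ Φs)))))
        (sym (prefix-suc n φ))
        (strengthen-antecedent-⋀ (prefix n φ) φt1 φt)
  where
  open Abbrev θ₀
  open Derivations θ₀
  φt φt1 : Form _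
  φt  = φ (fromℕ (suc n))
  φt1 = φ (inject₁ (fromℕ n))
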